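{- Let $(F_n)$ be the Fibonacci sequence, extended to index $-1$ by $F_{ -1}=1$. Let $F(m,n)$, $m,n\in\mathbb{N}=\{0,1,2,\dots\}$, be the double-recurrence Fibonacci numbers. Then for all $m,n\in\mathbb{N}$, with $k:=\min\{m,n\}$, \[ F(m,n)=F_{k}F_{|m-n|+2}+F_{k-1}F_{|m-n|}. \]
   Context: The Fibonacci sequence is given by $F_0=0$, $F_1=1$, $F_{n+2}=F_{n+1}+F_n$ for $n\ge 0$; the value $F_{ -1}=1$ is the one compatible with this recurrence ($F_1=F_0+F_{ -1}$). The double-recurrence Fibonacci numbers are the integers $F(m,n)$, $m,n\in\mathbb{N}$, determined by the recurrence $F(m,n)=F(m-1,n-1)+F(m-2,n-2)$ for all $m,n\ge 2$, together with the initial values $F(m,0)=F_m$, $F(m,1)=F_{m+1}$ for all $m\ge 0$, and $F(0,n)=F_n$, $F(1,n)=F_{n+1}$ for all $n\ge 0$. -}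

module Defs where

open import Data.Nat using (ℕ; zero; suc; _+_)

fib : ℕ → ℕ
fib zero = 0
fib (suc zero) = 1
fib (suc (suc n)) = fib (suc n) + fib n

-- fibPred k = F_{k-1}, using the extension F_{-1} = 1 (so fibPred 0 = 1)
fibPred : ℕ → ℕ
fibPred zero = 1
fibPred (suc k) = fib k

-- Double-recurrence Fibonacci numbers F(m,n):
--   F(0,n) = F_n, F(1,n) = F_{n+1}, F(m,0) = F_m, F(m,1) = F_{m+1},
--   F(m,n) = F(m-1,n-1) + F(m-2,n-2) for m,n ≥ 2.
-- (The overlapping initial values agree: F(0,0)=F_0, F(0,1)=F_1, F(1,0)=F_1, F(1,1)=F_2.)
dfib : ℕ → ℕ → ℕ
dfib zero n = fib n
dfib (suc zero) n = fib (suc n)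
dfib (suc (suc m)) zero = fib (suc (suc m))
dfib (suc (suc m)) (suc zero) = fib (suc (suc (suc m)))
dfib (suc (suc m)) (suc (suc n)) = dfib (suc m) (suc n) + dfib m n

-- Along a diagonal m - n = d the recurrence F(m,n) = F(m-1,n-1) + F(m-2,n-2) is the
-- Fibonacci recurrence in k = min(m,n), and so is k ↦ F_k F_{d+2} + F_{k-1} F_d, being a
-- linear combination of (F_k) and (F_{k-1}). Both sides agree for k = 0 and k = 1, where
-- they are F_d and F_{d+2}.
module Submission where

open import Defs
open import Data.Nat using (ℕ; zero; suc; _+_; _*_; _⊓_; ∣_-_∣)
open import Data.Nat.Properties using (+-identityʳ; *-identityˡ; +-comm)
open import Data.Nat.Solver using (module +-*-Solver)
open import Relation.Binary.PropositionalEquality using (_≡_; refl; sym; trans; cong; cong₂)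
open +-*-Solver using (solve; _:=_; _:+_; _:*_)

FibonacciRecurrent : (ℕ → ℕ) → Set
FibonacciRecurrent f = ∀ k → f (suc (suc k)) ≡ f (suc k) + f k

fib-recurrent : FibonacciRecurrent fib
fib-recurrent k = refl

fibPred-recurrent : FibonacciRecurrent fibPred
fibPred-recurrent zero    = refl
fibPred-recurrent (suc k) = refl

linearCombination-recurrent : ∀ f g → FibonacciRecurrent f → FibonacciRecurrent g →
  ∀ a b → FibonacciRecurrent (λ k → f k * a + g k * b)
linearCombination-recurrent f g f-rec g-rec a b k
  rewrite f-rec k | g-rec k =
  solve 6 (λ x y u v a b → (x :+ y) :* a :+ (u :+ v) :* b
                        := (x :* a :+ u :* b) :+ (y :* a :+ v :* b))
        refl (f (suc k)) (f k) (g (suc k)) (g k) a b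

diagonal : ℕ → ℕ → ℕ
diagonal d k = fib k * fib (d + 2) + fibPred k * fib d

diagonal-recurrent : ∀ d → FibonacciRecurrent (diagonal d)
diagonal-recurrent d =
  linearCombination-recurrent fib fibPred fib-recurrent fibPred-recurrent (fib (d + 2)) (fib d)

diagonal-zero : ∀ d → diagonal d 0 ≡ fib d
diagonal-zero d = +-identityʳ (fib d)

diagonal-one : ∀ d → diagonal d 1 ≡ fib (suc (suc d))
diagonal-one d = trans (+-identityʳ (1 * fib (d + 2)))
                       (trans (*-identityˡ (fib (d + 2))) (cong fib (+-comm d 2)))

dfib≡diagonal : ∀ m n → dfib m n ≡ diagonal ∣ m - n ∣ (m ⊓ n)
dfib≡diagonal zero          n             = sym (diagonal-zero n)
dfib≡diagonal (suc zero)    zero          = refl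
dfib≡diagonal (suc zero)    (suc n)       = sym (diagonal-one n)
dfib≡diagonal (suc (suc m)) zero          = sym (diagonal-zero (suc (suc m)))
dfib≡diagonal (suc (suc m)) (suc zero)    = sym (diagonal-one (suc m))
dfib≡diagonal (suc (suc m)) (suc (suc n)) =
  trans (cong₂ _+_ (dfib≡diagonal (suc m) (suc n)) (dfib≡diagonal m n))
        (sym (diagonal-recurrent ∣ m - n ∣ (m ⊓ n)))

proposition1 : (m n : ℕ) →
    dfib m n ≡ fib (m ⊓ n) * fib (∣ m - n ∣ + 2) + fibPred (m ⊓ n) * fib ∣ m - n ∣
proposition1 = dfib≡diagonal
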